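{- Let $t_1$ and $t_2$ be LE-$\mathcal{ALC}$ ABox terms not containing negation. Then for any consistent LE-$\mathcal{ALC}$ ABox $\mathcal{A}$, $\mathcal{A}\models t_1\vee t_2$ (i.e., every model of $\mathcal{A}$ satisfies $t_1$ or $t_2$) iff $\mathcal{A}\models t_1$ or $\mathcal{A}\models t_2$.
   Context: LE-$\mathcal{ALC}$: disjoint sets of object names and feature names; atomic concept names $D$ (not including $\top,\bot$); concepts $C::=D\mid C\wedge C\mid C\vee C\mid[R_\Box]C\mid\langle R_\Diamond\rangle C$. ABox terms: $aR_\Box x$, $xR_\Diamond a$, $aIx$, $a:C$, $x::C$ ($a$ object names, $x$ feature names), and $\neg\alpha$ for $\alpha$ any of these; an ABox is a finite set of terms. An interpretation is an enriched formal context $(A,X,I,R_\Box,R_\Diamond)$ ($I,R_\Box\subseteq A\times X$, $R_\Diamond\subseteq X\times A$, with $R_\Box^{(0)}[x],R_\Box^{(1)}[a],R_\Diamond^{(0)}[a],R_\Diamond^{(1)}[x]$ Galois-stable w.r.t. $I$, where $T^{(1)}[U']=\{v:\forall u\in U'\,uTv\}$, $T^{(0)}[V']=\{u:\forall v\in V'\,uTv\}$) with a map of object names into $A$, feature names into $X$, and atomic concepts to formal concepts $(\mathrm{ext},\mathrm{int})$ of $(A,X,I)$, extended to all concepts by lattice meet/join, $[R_\Box]c=(R_\Box^{(0)}[\mathrm{int}(c)],I^{(1)}[R_\Box^{(0)}[\mathrm{int}(c)]])$ and $\langle R_\Diamond\rangle c=(I^{(0)}[R_\Diamond^{(0)}[\mathrm{ext}(c)]],R_\Diamond^{(0)}[\mathrm{ext}(c)])$.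 $\mathcal{M}\models a:C$ iff $a^\mathcal{M}\in\mathrm{ext}(C^\mathcal{M})$, $\mathcal{M}\models x::C$ iff $x^\mathcal{M}\in\mathrm{int}(C^\mathcal{M})$, relational terms hold iff the corresponding relation holds, $\mathcal{M}\models\neg\alpha$ iff $\mathcal{M}\not\models\alpha$. An ABox is consistent if it has a model; $\mathcal{A}\models t$ means every model of $\mathcal{A}$ satisfies $t$. -}

module Defs where

open import Level using (0ℓ)
open import Data.Product using (_×_; _,_; proj₁; proj₂; Σ)
open import Data.Sum using (_⊎_)
open import Data.List using (List)
open import Data.List.Relation.Unary.All using (All)
open import Relation.Nullary using (¬_)

Pred : Set → Set₁
Pred A = A → Set

_⊆_ : {A : Set} → Pred A → Pred A → Set
P ⊆ Q = ∀ a → P a → Q a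

_≐_ : {A : Set} → Pred A → Pred A → Set
P ≐ Q = (P ⊆ Q) × (Q ⊆ P)

_⁽¹⁾[_] : {U V : Set} → (U → V → Set) → Pred U → Pred V
T ⁽¹⁾[ U' ] = λ v → ∀ u → U' u → T u v

_⁽⁰⁾[_] : {U V : Set} → (U → V → Set) → Pred V → Pred U
T ⁽⁰⁾[ V' ] = λ u → ∀ v → V' v → T u v

StableA : {A X : Set} → (A → X → Set) → Pred A → Set
StableA I B = (I ⁽⁰⁾[ I ⁽¹⁾[ B ] ]) ≐ B

StableX : {A X : Set} → (A → X → Set) → Pred X → Set
StableX I Y = (I ⁽¹⁾[ I ⁽⁰⁾[ Y ] ]) ≐ Y

module LE-ALC (ObjName FeatName ConceptName : Set) where

  infixr 6 _⊓_
  infixr 5 _⊔_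

  data Concept : Set where
    atom : ConceptName → Concept
    _⊓_  : Concept → Concept → Concept
    _⊔_  : Concept → Concept → Concept
    [R□]_ : Concept → Concept
    ⟨R◇⟩_ : Concept → Concept

  data BasicTerm : Set where
    _R□ᵗ_ : ObjName → FeatName → BasicTerm
    _R◇ᵗ_ : FeatName → ObjName → BasicTerm
    _Iᵗ_  : ObjName → FeatName → BasicTerm
    _∶_  : ObjName → Concept → BasicTerm
    _∷∶_ : FeatName → Concept → BasicTerm

  data Term : Set where
    pos : BasicTerm → Term
    neg : BasicTerm → Term

  ABox : Set
  ABox = List Term

  record Interpretation : Set₁ where
    field
      A  : Set
      X  : Set
      I  : A → X → Set
      R□ : A → X → Set
      R◇ : X → A → Set
      R□⁽⁰⁾-stable : ∀ x → StableA I (λ a → R□ a x)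
      R□⁽¹⁾-stable : ∀ a → StableX I (λ x → R□ a x)
      R◇⁽⁰⁾-stable : ∀ a → StableX I (λ x → R◇ x a)
      R◇⁽¹⁾-stable : ∀ x → StableA I (λ a → R◇ x a)
      obj  : ObjName → A
      feat : FeatName → X
      ext₀ : ConceptName → Pred A
      int₀ : ConceptName → Pred X
      ext₀-concept : ∀ D → ext₀ D ≐ (I ⁽⁰⁾[ int₀ D ])
      int₀-concept : ∀ D → int₀ D ≐ (I ⁽¹⁾[ ext₀ D ])

    ⟦_⟧ : Concept → Pred A × Pred X
    ⟦ atom D ⟧ = ext₀ D , int₀ D
    ⟦ C ⊓ C' ⟧ =
      let e = λ a → proj₁ ⟦ C ⟧ a × proj₁ ⟦ C' ⟧ a
      in e , I ⁽¹⁾[ e ]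
    ⟦ C ⊔ C' ⟧ =
      let i = λ x → proj₂ ⟦ C ⟧ x × proj₂ ⟦ C' ⟧ x
      in I ⁽⁰⁾[ i ] , i
    ⟦ [R□] C ⟧ =
      let e = R□ ⁽⁰⁾[ proj₂ ⟦ C ⟧ ]
      in e , I ⁽¹⁾[ e ]
    ⟦ ⟨R◇⟩ C ⟧ =
      let i = R◇ ⁽⁰⁾[ proj₁ ⟦ C ⟧ ]
      in I ⁽⁰⁾[ i ] , i

    ext : Concept → Pred A
    ext C = proj₁ ⟦ C ⟧

    int : Concept → Pred X
    int C = proj₂ ⟦ C ⟧

  open Interpretation

  _⊨ᵇ_ : Interpretation → BasicTerm → Set
  M ⊨ᵇ (a R□ᵗ x) = R□ M (obj M a) (feat M x)
  M ⊨ᵇ (x R◇ᵗ a) = R◇ M (feat M x) (obj M a)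
  M ⊨ᵇ (a Iᵗ x) = I M (obj M a) (feat M x)
  M ⊨ᵇ (a ∶ C)  = ext M C (obj M a)
  M ⊨ᵇ (x ∷∶ C) = int M C (feat M x)

  _⊨ᵗ_ : Interpretation → Term → Set
  M ⊨ᵗ pos t = M ⊨ᵇ t
  M ⊨ᵗ neg t = ¬ (M ⊨ᵇ t)

  _⊨ᴬ_ : Interpretation → ABox → Set
  M ⊨ᴬ 𝒜 = All (M ⊨ᵗ_) 𝒜

  Consistent : ABox → Set₁
  Consistent 𝒜 = Σ Interpretation (λ M → M ⊨ᴬ 𝒜)

  _⊩_ : ABox → BasicTerm → Set₁
  𝒜 ⊩ t = ∀ (M : Interpretation) → M ⊨ᴬ 𝒜 → M ⊨ᵇ t

  _⊩_∨_ : ABox → BasicTerm → BasicTerm → Set₁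
  𝒜 ⊩ t₁ ∨ t₂ = ∀ (M : Interpretation) → M ⊨ᴬ 𝒜 → (M ⊨ᵇ t₁) ⊎ (M ⊨ᵇ t₂)

{-# OPTIONS --safe #-}
module Submission where

-- Every basic term t is equivalent, in every model, to an inequality lhs t ≤ rhs t between
-- expressions in which an object (feature) name denotes the formal concept it generates and
-- □, ◇ are given their adjoints ◆ ⊣ □ and ◇ ⊣ ■. Taking both objects and features to be the
-- expressions and I the preorder derivable from the positive terms of 𝒜 gives a canonical
-- model, in which a basic term holds iff its inequality is derivable; by soundness, a
-- derivable inequality is entailed by 𝒜.
-- If 𝒜 has some model M, the canonical model also satisfies the negative terms of 𝒜: a
-- negated term true there would be derivable, hence true in M. So the canonical model is a
-- model of 𝒜, and whichever of t₁, t₂ it satisfies is derivable, hence entailed.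

open import Defs
open import Data.Product using (_×_; _,_; proj₁; proj₂)
open import Data.Sum as Sum using (_⊎_)
open import Data.List.Membership.Propositional using (_∈_)
open import Data.List.Relation.Unary.All using (lookup; tabulate)
open import Function using (flip; _∘_)
open import Relation.Unary using (_∩_)

module _ {A : Set} where

  ≐-refl : {P : Pred A} → P ≐ P
  ≐-refl = (λ _ p → p) , (λ _ p → p)

  ≐-sym : {P Q : Pred A} → P ≐ Q → Q ≐ P
  ≐-sym (P⊆Q , Q⊆P) = Q⊆P , P⊆Q

  ≐-trans : {P Q R : Pred A} → P ≐ Q → Q ≐ R → P ≐ R
  ≐-trans (P⊆Q , Q⊆P) (Q⊆R , R⊆Q) = (λ a → Q⊆R a ∘ P⊆Q a) , (λ a → Q⊆P a ∘ R⊆Q a)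

  ∩-cong : {P P' Q Q' : Pred A} → P ≐ P' → Q ≐ Q' → (P ∩ Q) ≐ (P' ∩ Q')
  ∩-cong (P⊆P' , P'⊆P) (Q⊆Q' , Q'⊆Q) =
    (λ a (p , q) → P⊆P' a p , Q⊆Q' a q) , (λ a (p , q) → P'⊆P a p , Q'⊆Q a q)

module _ {U V : Set} {T : U → V → Set} where

  ⁽⁰⁾-antitone : {Y Y' : Pred V} → Y ⊆ Y' → (T ⁽⁰⁾[ Y' ]) ⊆ (T ⁽⁰⁾[ Y ])
  ⁽⁰⁾-antitone Y⊆Y' u h v y = h v (Y⊆Y' v y)

  ⁽¹⁾-antitone : {B B' : Pred U} → B ⊆ B' → (T ⁽¹⁾[ B' ]) ⊆ (T ⁽¹⁾[ B ])
  ⁽¹⁾-antitone B⊆B' v h u b = h u (B⊆B' u b)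

  ⁽⁰⁾-cong : {Y Y' : Pred V} → Y ≐ Y' → (T ⁽⁰⁾[ Y ]) ≐ (T ⁽⁰⁾[ Y' ])
  ⁽⁰⁾-cong (Y⊆Y' , Y'⊆Y) = ⁽⁰⁾-antitone Y'⊆Y , ⁽⁰⁾-antitone Y⊆Y'

  ⁽¹⁾-cong : {B B' : Pred U} → B ≐ B' → (T ⁽¹⁾[ B ]) ≐ (T ⁽¹⁾[ B' ])
  ⁽¹⁾-cong (B⊆B' , B'⊆B) = ⁽¹⁾-antitone B'⊆B , ⁽¹⁾-antitone B⊆B'

-- Closedness on the feature side of a context I is closedness for flip I, since
-- (flip I) ⁽⁰⁾[ Y ] and I ⁽¹⁾[ Y ] coincide definitionally.
Closed : {U V : Set} → (U → V → Set) → Pred U → Set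
Closed S P = (S ⁽⁰⁾[ S ⁽¹⁾[ P ] ]) ⊆ P

module _ {U V : Set} {S : U → V → Set} where

  closed⇒stable : {P : Pred U} → Closed S P → (S ⁽⁰⁾[ S ⁽¹⁾[ P ] ]) ≐ P
  closed⇒stable closed = closed , λ u p v h → h u p

  closed-≐ : {P Q : Pred U} → P ≐ Q → Closed S P → Closed S Q
  closed-≐ (P⊆Q , Q⊆P) closed u h = P⊆Q u (closed u (⁽⁰⁾-antitone {T = S} (⁽¹⁾-antitone {T = S} Q⊆P) u h))

  ∩-closed : {P Q : Pred U} → Closed S P → Closed S Q → Closed S (P ∩ Q)
  ∩-closed P-closed Q-closed u h =
    P-closed u (⁽⁰⁾-antitone {T = S} (⁽¹⁾-antitone {T = S} (λ _ → proj₁)) u h) ,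
    Q-closed u (⁽⁰⁾-antitone {T = S} (⁽¹⁾-antitone {T = S} (λ _ → proj₂)) u h)

  column-closed : {v : V} → Closed S (λ u → S u v)
  column-closed u h = h _ (λ _ s → s)

  ⁽⁰⁾-closed : {W : Set} {T : U → W → Set} → (∀ w → Closed S (λ u → T u w)) →
               (Y : Pred W) → Closed S (T ⁽⁰⁾[ Y ])
  ⁽⁰⁾-closed columns-closed Y u h w y =
    columns-closed w u (⁽⁰⁾-antitone {T = S} (⁽¹⁾-antitone {T = S} (λ _ t → t w y)) u h)

  ⁽¹⁾-closed : {W : Set} {T : W → U → Set} → (∀ w → Closed S (T w)) →
               (B : Pred W) → Closed S (T ⁽¹⁾[ B ])
  ⁽¹⁾-closed {T = T} = ⁽⁰⁾-closed {T = flip T}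

  polar-closed : (Y : Pred V) → Closed S (S ⁽⁰⁾[ Y ])
  polar-closed = ⁽⁰⁾-closed (λ _ → column-closed)

  closure-least : {P : Pred U} {u : U} → Closed S P → P u → (S ⁽⁰⁾[ S u ]) ⊆ P
  closure-least P-closed p w h = P-closed w (λ v q → h v (q _ p))

module _ (ObjName FeatName ConceptName : Set) where
  open LE-ALC ObjName FeatName ConceptName

  infixr 6 _⋏_
  infixr 5 _⋎_
  infix 4 _⊢_≤_

  data Expr : Set where
    ob  : ObjName → Expr
    ft  : FeatName → Expr
    at  : ConceptName → Expr
    _⋏_ : Expr → Expr → Expr
    _⋎_ : Expr → Expr → Expr
    □_  : Expr → Expr
    ◆_  : Expr → Expr
    ◇_  : Expr → Expr
    ■_  : Expr → Expr

  ⌜_⌝ : Concept → Expr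
  ⌜ atom D ⌝   = at D
  ⌜ C ⊓ C' ⌝   = ⌜ C ⌝ ⋏ ⌜ C' ⌝
  ⌜ C ⊔ C' ⌝   = ⌜ C ⌝ ⋎ ⌜ C' ⌝
  ⌜ [R□] C ⌝   = □ ⌜ C ⌝
  ⌜ ⟨R◇⟩ C ⌝   = ◇ ⌜ C ⌝

  lhs rhs : BasicTerm → Expr
  lhs (a R□ᵗ x) = ob a
  lhs (x R◇ᵗ a) = ◇ ob a
  lhs (a Iᵗ x)  = ob a
  lhs (a ∶ C)   = ob a
  lhs (x ∷∶ C)  = ⌜ C ⌝
  rhs (a R□ᵗ x) = □ ft x
  rhs (x R◇ᵗ a) = ft x
  rhs (a Iᵗ x)  = ft x
  rhs (a ∶ C)   = ⌜ C ⌝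
  rhs (x ∷∶ C)  = ft x

  data _⊢_≤_ (𝒜 : ABox) : Expr → Expr → Set where
    ≤-refl     : ∀ {u} → 𝒜 ⊢ u ≤ u
    ≤-trans    : ∀ {u v w} → 𝒜 ⊢ u ≤ v → 𝒜 ⊢ v ≤ w → 𝒜 ⊢ u ≤ w
    ⋏-lower₁   : ∀ {u v} → 𝒜 ⊢ u ⋏ v ≤ u
    ⋏-lower₂   : ∀ {u v} → 𝒜 ⊢ u ⋏ v ≤ v
    ⋏-greatest : ∀ {u v w} → 𝒜 ⊢ w ≤ u → 𝒜 ⊢ w ≤ v → 𝒜 ⊢ w ≤ u ⋏ v
    ⋎-upper₁   : ∀ {u v} → 𝒜 ⊢ u ≤ u ⋎ v
    ⋎-upper₂   : ∀ {u v} → 𝒜 ⊢ v ≤ u ⋎ v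
    ⋎-least    : ∀ {u v w} → 𝒜 ⊢ u ≤ w → 𝒜 ⊢ v ≤ w → 𝒜 ⊢ u ⋎ v ≤ w
    ◆⇒□        : ∀ {u v} → 𝒜 ⊢ ◆ u ≤ v → 𝒜 ⊢ u ≤ □ v
    □⇒◆        : ∀ {u v} → 𝒜 ⊢ u ≤ □ v → 𝒜 ⊢ ◆ u ≤ v
    ◇⇒■        : ∀ {u v} → 𝒜 ⊢ ◇ u ≤ v → 𝒜 ⊢ u ≤ ■ v
    ■⇒◇        : ∀ {u v} → 𝒜 ⊢ u ≤ ■ v → 𝒜 ⊢ ◇ u ≤ v
    axiom      : ∀ {t} → pos t ∈ 𝒜 → 𝒜 ⊢ lhs t ≤ rhs t

  □-mono : ∀ {𝒜 u v} → 𝒜 ⊢ u ≤ v → 𝒜 ⊢ □ u ≤ □ v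
  □-mono u≤v = ◆⇒□ (≤-trans (□⇒◆ ≤-refl) u≤v)

  ◇-mono : ∀ {𝒜 u v} → 𝒜 ⊢ u ≤ v → 𝒜 ⊢ ◇ u ≤ ◇ v
  ◇-mono u≤v = ■⇒◇ (≤-trans u≤v (◇⇒■ ≤-refl))

  module Semantics (M : Interpretation) where
    open Interpretation M

    ⟦_⟧ᴱ : Expr → Pred A
    ⟦ ob a ⟧ᴱ  = I ⁽⁰⁾[ I (obj a) ]
    ⟦ ft x ⟧ᴱ  = λ u → I u (feat x)
    ⟦ at D ⟧ᴱ  = ext₀ D
    ⟦ u ⋏ v ⟧ᴱ = ⟦ u ⟧ᴱ ∩ ⟦ v ⟧ᴱ
    ⟦ u ⋎ v ⟧ᴱ = I ⁽⁰⁾[ (I ⁽¹⁾[ ⟦ u ⟧ᴱ ]) ∩ (I ⁽¹⁾[ ⟦ v ⟧ᴱ ]) ]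
    ⟦ □ u ⟧ᴱ   = R□ ⁽⁰⁾[ I ⁽¹⁾[ ⟦ u ⟧ᴱ ] ]
    ⟦ ◆ u ⟧ᴱ   = I ⁽⁰⁾[ R□ ⁽¹⁾[ ⟦ u ⟧ᴱ ] ]
    ⟦ ◇ u ⟧ᴱ   = I ⁽⁰⁾[ R◇ ⁽⁰⁾[ ⟦ u ⟧ᴱ ] ]
    ⟦ ■ u ⟧ᴱ   = R◇ ⁽¹⁾[ I ⁽¹⁾[ ⟦ u ⟧ᴱ ] ]

    ⟦ob⟧-self : ∀ a → ⟦ ob a ⟧ᴱ (obj a)
    ⟦ob⟧-self a x p = p

    R□⁽¹⁾-closed : (B : Pred A) → Closed (flip I) (R□ ⁽¹⁾[ B ])
    R□⁽¹⁾-closed = ⁽¹⁾-closed (proj₁ ∘ R□⁽¹⁾-stable)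

    R◇⁽⁰⁾-closed : (B : Pred A) → Closed (flip I) (R◇ ⁽⁰⁾[ B ])
    R◇⁽⁰⁾-closed = ⁽⁰⁾-closed (proj₁ ∘ R◇⁽⁰⁾-stable)

    ⟦⟧ᴱ-closed : ∀ e → Closed I ⟦ e ⟧ᴱ
    ⟦⟧ᴱ-closed (ob a)  = polar-closed _
    ⟦⟧ᴱ-closed (ft x)  = column-closed
    ⟦⟧ᴱ-closed (at D)  = closed-≐ (≐-sym (ext₀-concept D)) (polar-closed _)
    ⟦⟧ᴱ-closed (u ⋏ v) = ∩-closed (⟦⟧ᴱ-closed u) (⟦⟧ᴱ-closed v)
    ⟦⟧ᴱ-closed (u ⋎ v) = polar-closed _
    ⟦⟧ᴱ-closed (□ u)   = ⁽⁰⁾-closed (proj₁ ∘ R□⁽⁰⁾-stable) _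
    ⟦⟧ᴱ-closed (◆ u)   = polar-closed _
    ⟦⟧ᴱ-closed (◇ u)   = polar-closed _
    ⟦⟧ᴱ-closed (■ u)   = ⁽¹⁾-closed (proj₁ ∘ R◇⁽¹⁾-stable) _

    int-closed : ∀ C → Closed (flip I) (int C)
    int-closed (atom D)   = closed-≐ (≐-sym (int₀-concept D)) (polar-closed _)
    int-closed (C ⊓ C')   = polar-closed _
    int-closed (C ⊔ C')   = ∩-closed (int-closed C) (int-closed C')
    int-closed ([R□] C)   = polar-closed _
    int-closed (⟨R◇⟩ C)   = R◇⁽⁰⁾-closed _

    int≐I⁽¹⁾[ext] : ∀ C → int C ≐ (I ⁽¹⁾[ ext C ])
    int≐I⁽¹⁾[ext] (atom D) = int₀-concept D
    int≐I⁽¹⁾[ext] (C ⊓ C') = ≐-refl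
    int≐I⁽¹⁾[ext] (C ⊔ C') = ≐-sym (closed⇒stable (int-closed (C ⊔ C')))
    int≐I⁽¹⁾[ext] ([R□] C) = ≐-refl
    int≐I⁽¹⁾[ext] (⟨R◇⟩ C) = ≐-sym (closed⇒stable (int-closed (⟨R◇⟩ C)))

    ⟦⌜⌝⟧ᴱ≐ext : ∀ C → ⟦ ⌜ C ⌝ ⟧ᴱ ≐ ext C
    I⁽¹⁾[⟦⌜⌝⟧ᴱ]≐int : ∀ C → (I ⁽¹⁾[ ⟦ ⌜ C ⌝ ⟧ᴱ ]) ≐ int C

    ⟦⌜⌝⟧ᴱ≐ext (atom D) = ≐-refl
    ⟦⌜⌝⟧ᴱ≐ext (C ⊓ C') = ∩-cong (⟦⌜⌝⟧ᴱ≐ext C) (⟦⌜⌝⟧ᴱ≐ext C')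
    ⟦⌜⌝⟧ᴱ≐ext (C ⊔ C') = ⁽⁰⁾-cong (∩-cong (I⁽¹⁾[⟦⌜⌝⟧ᴱ]≐int C) (I⁽¹⁾[⟦⌜⌝⟧ᴱ]≐int C'))
    ⟦⌜⌝⟧ᴱ≐ext ([R□] C) = ⁽⁰⁾-cong (I⁽¹⁾[⟦⌜⌝⟧ᴱ]≐int C)
    ⟦⌜⌝⟧ᴱ≐ext (⟨R◇⟩ C) = ⁽⁰⁾-cong (⁽⁰⁾-cong (⟦⌜⌝⟧ᴱ≐ext C))

    I⁽¹⁾[⟦⌜⌝⟧ᴱ]≐int C = ≐-trans (⁽¹⁾-cong (⟦⌜⌝⟧ᴱ≐ext C)) (≐-sym (int≐I⁽¹⁾[ext] C))

    ⊨ᵇ⇒⟦lhs⟧⊆⟦rhs⟧ : ∀ t → M ⊨ᵇ t → ⟦ lhs t ⟧ᴱ ⊆ ⟦ rhs t ⟧ᴱ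
    ⊨ᵇ⇒⟦lhs⟧⊆⟦rhs⟧ (a R□ᵗ x) aR□x =
      closure-least (⟦⟧ᴱ-closed (□ ft x)) (closure-least (proj₁ (R□⁽¹⁾-stable (obj a))) aR□x)
    ⊨ᵇ⇒⟦lhs⟧⊆⟦rhs⟧ (x R◇ᵗ a) xR◇a u p =
      p (feat x) (closure-least (proj₁ (R◇⁽¹⁾-stable (feat x))) xR◇a)
    ⊨ᵇ⇒⟦lhs⟧⊆⟦rhs⟧ (a Iᵗ x) aIx = closure-least column-closed aIx
    ⊨ᵇ⇒⟦lhs⟧⊆⟦rhs⟧ (a ∶ C) a∈C =
      closure-least (⟦⟧ᴱ-closed ⌜ C ⌝) (proj₂ (⟦⌜⌝⟧ᴱ≐ext C) (obj a) a∈C)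
    ⊨ᵇ⇒⟦lhs⟧⊆⟦rhs⟧ (x ∷∶ C) x∈C u p =
      proj₁ (int≐I⁽¹⁾[ext] C) (feat x) x∈C u (proj₁ (⟦⌜⌝⟧ᴱ≐ext C) u p)

    ⟦lhs⟧⊆⟦rhs⟧⇒⊨ᵇ : ∀ t → ⟦ lhs t ⟧ᴱ ⊆ ⟦ rhs t ⟧ᴱ → M ⊨ᵇ t
    ⟦lhs⟧⊆⟦rhs⟧⇒⊨ᵇ (a R□ᵗ x) s = s (obj a) (⟦ob⟧-self a) (feat x) (λ u p → p)
    ⟦lhs⟧⊆⟦rhs⟧⇒⊨ᵇ (x R◇ᵗ a) s = R◇⁽⁰⁾-closed _ (feat x) s (obj a) (⟦ob⟧-self a)
    ⟦lhs⟧⊆⟦rhs⟧⇒⊨ᵇ (a Iᵗ x) s = s (obj a) (⟦ob⟧-self a)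
    ⟦lhs⟧⊆⟦rhs⟧⇒⊨ᵇ (a ∶ C) s = proj₁ (⟦⌜⌝⟧ᴱ≐ext C) (obj a) (s (obj a) (⟦ob⟧-self a))
    ⟦lhs⟧⊆⟦rhs⟧⇒⊨ᵇ (x ∷∶ C) s =
      proj₂ (int≐I⁽¹⁾[ext] C) (feat x) (λ u p → s u (proj₂ (⟦⌜⌝⟧ᴱ≐ext C) u p))

    sound : ∀ {𝒜 u v} → M ⊨ᴬ 𝒜 → 𝒜 ⊢ u ≤ v → ⟦ u ⟧ᴱ ⊆ ⟦ v ⟧ᴱ
    sound M⊨𝒜 ≤-refl a p = p
    sound M⊨𝒜 (≤-trans u≤v v≤w) a p = sound M⊨𝒜 v≤w a (sound M⊨𝒜 u≤v a p)
    sound M⊨𝒜 ⋏-lower₁ a p = proj₁ p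
    sound M⊨𝒜 ⋏-lower₂ a p = proj₂ p
    sound M⊨𝒜 (⋏-greatest w≤u w≤v) a p = sound M⊨𝒜 w≤u a p , sound M⊨𝒜 w≤v a p
    sound M⊨𝒜 ⋎-upper₁ a p x q = proj₁ q a p
    sound M⊨𝒜 ⋎-upper₂ a p x q = proj₂ q a p
    sound M⊨𝒜 (⋎-least {w = w} u≤w v≤w) a p =
      ⟦⟧ᴱ-closed w a (⁽⁰⁾-antitone {T = I} (λ x q → ⁽¹⁾-antitone {T = I} (sound M⊨𝒜 u≤w) x q ,
                                             ⁽¹⁾-antitone {T = I} (sound M⊨𝒜 v≤w) x q) a p)
    sound M⊨𝒜 (◆⇒□ {u} ◆u≤v) a p x q =
      R□⁽¹⁾-closed ⟦ u ⟧ᴱ x (⁽¹⁾-antitone {T = I} (sound M⊨𝒜 ◆u≤v) x q) a p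
    sound M⊨𝒜 (□⇒◆ {v = v} u≤□v) a p =
      ⟦⟧ᴱ-closed v a (λ x q → p x (λ a' r → sound M⊨𝒜 u≤□v a' r x q))
    sound M⊨𝒜 (◇⇒■ {u} ◇u≤v) a p x q =
      R◇⁽⁰⁾-closed ⟦ u ⟧ᴱ x (⁽¹⁾-antitone {T = I} (sound M⊨𝒜 ◇u≤v) x q) a p
    sound M⊨𝒜 (■⇒◇ {v = v} u≤■v) a p =
      ⟦⟧ᴱ-closed v a (λ x q → p x (λ a' r → sound M⊨𝒜 u≤■v a' r x q))
    sound M⊨𝒜 (axiom {t} t∈𝒜) = ⊨ᵇ⇒⟦lhs⟧⊆⟦rhs⟧ t (lookup M⊨𝒜 t∈𝒜)

  derivable⇒entailed : ∀ {𝒜} t → 𝒜 ⊢ lhs t ≤ rhs t → 𝒜 ⊩ t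
  derivable⇒entailed t lhs≤rhs M M⊨𝒜 = ⟦lhs⟧⊆⟦rhs⟧⇒⊨ᵇ t (sound M⊨𝒜 lhs≤rhs)
    where open Semantics M

  module Canonical (𝒜 : ABox) where

    ↓ ↑ : Expr → Pred Expr
    ↓ u = λ w → 𝒜 ⊢ w ≤ u
    ↑ u = λ w → 𝒜 ⊢ u ≤ w

    ⁽¹⁾[↓]≐↑ : {B : Pred Expr} {u : Expr} → B ≐ ↓ u → ((𝒜 ⊢_≤_) ⁽¹⁾[ B ]) ≐ ↑ u
    ⁽¹⁾[↓]≐↑ (B⊆↓u , ↓u⊆B) =
      (λ v h → h _ (↓u⊆B _ ≤-refl)) , (λ v u≤v w b → ≤-trans (B⊆↓u w b) u≤v)

    ⁽⁰⁾[↑]≐↓ : {Y : Pred Expr} {u : Expr} → Y ≐ ↑ u → ((𝒜 ⊢_≤_) ⁽⁰⁾[ Y ]) ≐ ↓ u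
    ⁽⁰⁾[↑]≐↓ (Y⊆↑u , ↑u⊆Y) =
      (λ w h → h _ (↑u⊆Y _ ≤-refl)) , (λ w w≤u v y → ≤-trans w≤u (Y⊆↑u v y))

    ≐↓⇒stable : {B : Pred Expr} {u : Expr} → B ≐ ↓ u → StableA (𝒜 ⊢_≤_) B
    ≐↓⇒stable B≐↓u = ≐-trans (⁽⁰⁾[↑]≐↓ (⁽¹⁾[↓]≐↑ B≐↓u)) (≐-sym B≐↓u)

    ≐↑⇒stable : {Y : Pred Expr} {u : Expr} → Y ≐ ↑ u → StableX (𝒜 ⊢_≤_) Y
    ≐↑⇒stable Y≐↑u = ≐-trans (⁽¹⁾[↓]≐↑ (⁽⁰⁾[↑]≐↓ Y≐↑u)) (≐-sym Y≐↑u)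

    ↓-⋏ : {u v : Expr} → (↓ u ∩ ↓ v) ≐ ↓ (u ⋏ v)
    ↓-⋏ = (λ w (w≤u , w≤v) → ⋏-greatest w≤u w≤v) ,
          (λ w w≤u⋏v → ≤-trans w≤u⋏v ⋏-lower₁ , ≤-trans w≤u⋏v ⋏-lower₂)

    ↑-⋎ : {u v : Expr} → (↑ u ∩ ↑ v) ≐ ↑ (u ⋎ v)
    ↑-⋎ = (λ w (u≤w , v≤w) → ⋎-least u≤w v≤w) ,
          (λ w u⋎v≤w → ≤-trans ⋎-upper₁ u⋎v≤w , ≤-trans ⋎-upper₂ u⋎v≤w)

    ◆⊣□ : {u : Expr} → (λ v → 𝒜 ⊢ u ≤ □ v) ≐ ↑ (◆ u)
    ◆⊣□ = (λ _ → □⇒◆) , (λ _ → ◆⇒□)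

    ◇⊣■ : {v : Expr} → (λ u → 𝒜 ⊢ ◇ u ≤ v) ≐ ↓ (■ v)
    ◇⊣■ = (λ _ → ◇⇒■) , (λ _ → ■⇒◇)

    R□⁽⁰⁾[↑]≐↓□ : {Y : Pred Expr} {u : Expr} → Y ≐ ↑ u →
                  ((λ w v → 𝒜 ⊢ w ≤ □ v) ⁽⁰⁾[ Y ]) ≐ ↓ (□ u)
    R□⁽⁰⁾[↑]≐↓□ (Y⊆↑u , ↑u⊆Y) =
      (λ w h → h _ (↑u⊆Y _ ≤-refl)) , (λ w w≤□u v y → ≤-trans w≤□u (□-mono (Y⊆↑u v y)))

    R◇⁽⁰⁾[↓]≐↑◇ : {B : Pred Expr} {u : Expr} → B ≐ ↓ u →
                  ((λ v w → 𝒜 ⊢ ◇ w ≤ v) ⁽⁰⁾[ B ]) ≐ ↑ (◇ u)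
    R◇⁽⁰⁾[↓]≐↑◇ (B⊆↓u , ↓u⊆B) =
      (λ v h → h _ (↓u⊆B _ ≤-refl)) , (λ v ◇u≤v w b → ≤-trans (◇-mono (B⊆↓u w b)) ◇u≤v)

    canonical : Interpretation
    canonical = record
      { A = Expr ; X = Expr ; I = 𝒜 ⊢_≤_
      ; R□ = λ u v → 𝒜 ⊢ u ≤ □ v
      ; R◇ = λ v u → 𝒜 ⊢ ◇ u ≤ v
      ; R□⁽⁰⁾-stable = λ _ → ≐↓⇒stable ≐-refl
      ; R□⁽¹⁾-stable = λ _ → ≐↑⇒stable ◆⊣□
      ; R◇⁽⁰⁾-stable = λ _ → ≐↑⇒stable ≐-refl
      ; R◇⁽¹⁾-stable = λ _ → ≐↓⇒stable ◇⊣■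
      ; obj = ob ; feat = ft
      ; ext₀ = ↓ ∘ at
      ; int₀ = ↑ ∘ at
      ; ext₀-concept = λ _ → ≐-sym (⁽⁰⁾[↑]≐↓ ≐-refl)
      ; int₀-concept = λ _ → ≐-sym (⁽¹⁾[↓]≐↑ ≐-refl)
      }

    open Interpretation canonical using (ext; int)

    truth-lemma : ∀ C → (ext C ≐ ↓ ⌜ C ⌝) × (int C ≐ ↑ ⌜ C ⌝)
    truth-lemma (atom D) = ≐-refl , ≐-refl
    truth-lemma (C ⊓ C') = ext≐ , ⁽¹⁾[↓]≐↑ ext≐
      where
        ext≐ : ext (C ⊓ C') ≐ ↓ ⌜ C ⊓ C' ⌝
        ext≐ = ≐-trans (∩-cong (proj₁ (truth-lemma C)) (proj₁ (truth-lemma C'))) ↓-⋏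
    truth-lemma (C ⊔ C') = ⁽⁰⁾[↑]≐↓ int≐ , int≐
      where
        int≐ : int (C ⊔ C') ≐ ↑ ⌜ C ⊔ C' ⌝
        int≐ = ≐-trans (∩-cong (proj₂ (truth-lemma C)) (proj₂ (truth-lemma C'))) ↑-⋎
    truth-lemma ([R□] C) = ext≐ , ⁽¹⁾[↓]≐↑ ext≐
      where
        ext≐ : ext ([R□] C) ≐ ↓ ⌜ [R□] C ⌝
        ext≐ = R□⁽⁰⁾[↑]≐↓□ (proj₂ (truth-lemma C))
    truth-lemma (⟨R◇⟩ C) = ⁽⁰⁾[↑]≐↓ int≐ , int≐
      where
        int≐ : int (⟨R◇⟩ C) ≐ ↑ ⌜ ⟨R◇⟩ C ⌝
        int≐ = R◇⁽⁰⁾[↓]≐↑◇ (proj₁ (truth-lemma C))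

    canonical⊨ᵇ⇒derivable : ∀ t → canonical ⊨ᵇ t → 𝒜 ⊢ lhs t ≤ rhs t
    canonical⊨ᵇ⇒derivable (a R□ᵗ x) h = h
    canonical⊨ᵇ⇒derivable (x R◇ᵗ a) h = h
    canonical⊨ᵇ⇒derivable (a Iᵗ x)  h = h
    canonical⊨ᵇ⇒derivable (a ∶ C)   h = proj₁ (proj₁ (truth-lemma C)) (ob a) h
    canonical⊨ᵇ⇒derivable (x ∷∶ C)  h = proj₁ (proj₂ (truth-lemma C)) (ft x) h

    derivable⇒canonical⊨ᵇ : ∀ t → 𝒜 ⊢ lhs t ≤ rhs t → canonical ⊨ᵇ t
    derivable⇒canonical⊨ᵇ (a R□ᵗ x) d = d
    derivable⇒canonical⊨ᵇ (x R◇ᵗ a) d = d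
    derivable⇒canonical⊨ᵇ (a Iᵗ x)  d = d
    derivable⇒canonical⊨ᵇ (a ∶ C)   d = proj₂ (proj₁ (truth-lemma C)) (ob a) d
    derivable⇒canonical⊨ᵇ (x ∷∶ C)  d = proj₂ (proj₂ (truth-lemma C)) (ft x) d

    canonical⊨ᵇ⇒entailed : ∀ t → canonical ⊨ᵇ t → 𝒜 ⊩ t
    canonical⊨ᵇ⇒entailed t = derivable⇒entailed t ∘ canonical⊨ᵇ⇒derivable t

    canonical-model : Consistent 𝒜 → canonical ⊨ᴬ 𝒜
    canonical-model (M , M⊨𝒜) = tabulate canonical⊨
      where
        canonical⊨ : ∀ {s} → s ∈ 𝒜 → canonical ⊨ᵗ s
        canonical⊨ {pos t} t∈𝒜 = derivable⇒canonical⊨ᵇ t (axiom t∈𝒜)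
        canonical⊨ {neg t} ¬t∈𝒜 canonical⊨t =
          lookup M⊨𝒜 ¬t∈𝒜 (canonical⊨ᵇ⇒entailed t canonical⊨t M M⊨𝒜)

  disjunction-property : ∀ t₁ t₂ {𝒜} → Consistent 𝒜 → 𝒜 ⊩ t₁ ∨ t₂ → (𝒜 ⊩ t₁) ⊎ (𝒜 ⊩ t₂)
  disjunction-property t₁ t₂ {𝒜} consistent 𝒜⊩t₁∨t₂ =
    Sum.map (canonical⊨ᵇ⇒entailed t₁) (canonical⊨ᵇ⇒entailed t₂)
            (𝒜⊩t₁∨t₂ canonical (canonical-model consistent))
    where open Canonical 𝒜

lemma2 : {ObjName FeatName ConceptName : Set} →
    let open LE-ALC ObjName FeatName ConceptName in
    (t₁ t₂ : BasicTerm) (𝒜 : ABox) → Consistent 𝒜 →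
    ((𝒜 ⊩ t₁ ∨ t₂) → (𝒜 ⊩ t₁) ⊎ (𝒜 ⊩ t₂)) × ((𝒜 ⊩ t₁) ⊎ (𝒜 ⊩ t₂) → (𝒜 ⊩ t₁ ∨ t₂))
lemma2 {ObjName} {FeatName} {ConceptName} t₁ t₂ 𝒜 consistent =
  disjunction-property ObjName FeatName ConceptName t₁ t₂ consistent ,
  λ 𝒜⊩t₁⊎𝒜⊩t₂ M M⊨𝒜 → Sum.map (λ 𝒜⊩t₁ → 𝒜⊩t₁ M M⊨𝒜) (λ 𝒜⊩t₂ → 𝒜⊩t₂ M M⊨𝒜) 𝒜⊩t₁⊎𝒜⊩t₂
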